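{- For a positive integer $n$, $$\bigl|\{p \text{ prime}:\ n^{2/3}\le p\le 2n,\ p^2\mid i^2+1 \text{ for some positive integer } i\le n\}\bigr|\ll n^{2/3}.$$ -}

module Defs where

open import Data.Nat using (ℕ; suc; _+_; _*_; _^_; _≤_)
open import Data.Nat.Divisibility using (_∣_)
open import Data.Nat.Primality using (Prime)
open import Data.Product using (_×_; ∃-syntax)

-- The real inequality n^{2/3} ≤ p is written equivalently as n² ≤ p³.
InSet : ℕ → ℕ → Set
InSet n p =
  Prime p × (n ^ 2 ≤ p ^ 3) × (p ≤ 2 * n) ×
  (∃[ i ] (1 ≤ i × i ≤ n × (p ^ 2 ∣ i ^ 2 + 1)))

module Submission where

-- Write i² + 1 = k p².  The key fact is a Pell-type separation lemma: two such
-- solutions with the same k, non-proportional (i, p), (j, q) and p < q satisfy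
-- q² ≥ (k + 1) p².  It follows from the Vieta-type identity q = x p + y i with
-- x = k p q − i j > 0 and y = j p − i q > 0 (the case i q > j p gives p ≥ q).
-- Distinct primes are never proportional, since p ∤ i.
-- Then, at the cube scale a with a³ ≤ n < 8a³ (so a² ≤ p, 3p < 48a³ and
-- k p² ≤ (8a³)²), each prime is coded by (k, ⌊3p/a²⌋) if k < 8a — same-k primes
-- differ by a factor √2 > 4/3 — and by k ≤ 64a² otherwise — one large k shared
-- by two primes would give k q² > (8a³)².  The code takes 448a² + 1 values.

open import Defs
open import Data.Nat using (ℕ; zero; suc; pred; _+_; _*_; _∸_; _^_; _/_; _≤_; _<_; _<?_; z≤n; s≤s; NonZero; nonTrivial⇒≢1; >-nonZero⁻¹)
open import Data.Nat.Properties
open import Data.Nat.DivMod using (m/n≡1+[m∸n]/n; /-monoˡ-≤; m<n*o⇒m/o<n)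
open import Data.Nat.Divisibility using (_∣_; divides; ∣1⇒≡1; ∣m+n∣m⇒∣n; ∣m⇒∣m*n)
open import Data.Nat.Primality using (Prime; euclidsLemma; prime⇒irreducible; prime⇒nonTrivial)
open import Data.Nat.Tactic.RingSolver using (solve-∀)
open import Data.Fin using (Fin; zero; suc; fromℕ<; combine; join; splitAt)
open import Data.Fin.Properties using (injective⇒≤; combine-injective; fromℕ<-injective; splitAt-join)
open import Data.Product using (_×_; ∃-syntax; _,_; proj₁; proj₂)
open import Data.Sum using (_⊎_; inj₁; inj₂; [_,_]′)
open import Data.Sum.Properties using (inj₁-injective; inj₂-injective)
open import Data.List using (List; length; lookup)
open import Data.List.Membership.Propositional.Properties using (∈-lookup)
open import Data.List.Relation.Unary.All using (All)
import Data.List.Relation.Unary.All as All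
open import Data.List.Relation.Unary.AllPairs using (_∷_)
open import Data.List.Relation.Unary.Unique.Propositional using (Unique)
open import Function.Definitions using (Injective)
open import Relation.Binary.Definitions using (tri<; tri≈; tri>)
open import Relation.Binary.PropositionalEquality
open import Relation.Nullary using (yes; no; contradiction)

unique-lookup-injective : ∀ {A : Set} {xs : List A} → Unique xs →
                          ∀ ι ι′ → lookup xs ι ≡ lookup xs ι′ → ι ≡ ι′
unique-lookup-injective (_ ∷ _) zero zero _ = refl
unique-lookup-injective (x∉ ∷ _) zero (suc ι′) e = contradiction e (All.lookup x∉ (∈-lookup ι′))
unique-lookup-injective (x∉ ∷ _) (suc ι) zero e = contradiction (sym e) (All.lookup x∉ (∈-lookup ι))
unique-lookup-injective (_ ∷ u) (suc ι) (suc ι′) e = cong suc (unique-lookup-injective u ι ι′ e)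

length-≤-by-code : ∀ {A : Set} {P : A → Set} {B : ℕ} (code : ∀ {x} → P x → Fin B) →
                   (∀ {x y} (u : P x) (v : P y) → code u ≡ code v → x ≡ y) →
                   ∀ {xs} → Unique xs → All P xs → length xs ≤ B
length-≤-by-code code code-injective {xs} uniq ws = injective⇒≤ position-injective
  where
  position-code : Fin (length xs) → Fin _
  position-code ι = code (All.lookup ws (∈-lookup ι))

  position-injective : Injective _≡_ _≡_ position-code
  position-injective e = unique-lookup-injective uniq _ _ (code-injective _ _ e)

join-injective : ∀ m n {c d : Fin m ⊎ Fin n} → join m n c ≡ join m n d → c ≡ d
join-injective m n {c} {d} e = begin
  c                      ≡⟨ sym (splitAt-join m n c) ⟩
  splitAt m (join m n c) ≡⟨ cong (splitAt m) e ⟩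
  splitAt m (join m n d) ≡⟨ splitAt-join m n d ⟩
  d                      ∎
  where open ≡-Reasoning

square-cancel-≤ : ∀ {m n} → m * m ≤ n * n → m ≤ n
square-cancel-≤ le = ≮⇒≥ (λ n<m → <⇒≱ (*-mono-< n<m n<m) le)

square-cancel-< : ∀ {m n} → m * m < n * n → m < n
square-cancel-< lt = ≰⇒> (λ n≤m → <⇒≱ lt (*-mono-≤ n≤m n≤m))

positive-gap : ∀ {m n} → m < n → ∃[ d ] (m + suc d ≡ n)
positive-gap {m} m<n with d , e ← m≤n⇒∃[o]m+o≡n m<n = d , trans (+-suc m d) e

/-step : ∀ m d .{{_ : NonZero d}} → m / d < (m + d) / d
/-step m d = ≤-reflexive (sym (begin
  (m + d) / d           ≡⟨ m/n≡1+[m∸n]/n (m≤n+m d m) ⟩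
  suc ((m + d ∸ d) / d) ≡⟨ cong (λ r → suc (r / d)) (m+n∸n≡m m d) ⟩
  suc (m / d)           ∎))
  where open ≡-Reasoning

square-of-sum : ∀ p i → 1 ≤ p → 1 ≤ i → p * p + (i * i + 1) ≤ (p + i) * (p + i)
square-of-sum (suc p) (suc i) _ _ = ≤-trans (m≤m+n _ (1 + 2 * (p * i + p + i)))
                                             (≤-reflexive (expand p i))
  where
  expand : ∀ p i → suc p * suc p + (suc i * suc i + 1) + (1 + 2 * (p * i + p + i))
                   ≡ (suc p + suc i) * (suc p + suc i)
  expand = solve-∀

pell-positive : ∀ i k p → i * i + 1 ≡ k * (p * p) → 1 ≤ k × 1 ≤ p
pell-positive i k p pell = factors-positive k p (≤-trans (m≤n+m 1 (i * i)) (≤-reflexive pell))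
  where
  factors-positive : ∀ k p → 1 ≤ k * (p * p) → 1 ≤ k × 1 ≤ p
  factors-positive (suc k) (suc p) _ = s≤s z≤n , s≤s z≤n
  factors-positive (suc k) zero le = contradiction (≤-trans le (≤-reflexive (*-zeroʳ (suc k)))) λ ()

descent : ∀ i j k p q x y → i * i + 1 ≡ k * (p * p) → i * j + x ≡ k * (p * q) →
          i * q + y ≡ j * p → x * p + y * i ≡ q
descent i j k p q x y pell ex ey = +-cancelʳ-≡ (i * j * p + i * i * q) _ _ (begin
  (x * p + y * i) + (i * j * p + i * i * q) ≡⟨ regroup i j p q x y ⟩
  (i * j + x) * p + (i * q + y) * i         ≡⟨ cong₂ (λ s t → s * p + t * i) ex ey ⟩
  k * (p * q) * p + j * p * i               ≡⟨ collect i j k p q ⟩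
  k * (p * p) * q + i * j * p               ≡⟨ cong (λ s → s * q + i * j * p) (sym pell) ⟩
  (i * i + 1) * q + i * j * p               ≡⟨ expand i j p q ⟩
  q + (i * j * p + i * i * q)               ∎)
  where
  open ≡-Reasoning
  regroup : ∀ i j p q x y → (x * p + y * i) + (i * j * p + i * i * q)
                            ≡ (i * j + x) * p + (i * q + y) * i
  regroup = solve-∀
  collect : ∀ i j k p q → k * (p * q) * p + j * p * i ≡ k * (p * p) * q + i * j * p
  collect = solve-∀
  expand : ∀ i j p q → (i * i + 1) * q + i * j * p ≡ q + (i * j * p + i * i * q)
  expand = solve-∀

-- For two solutions with the same k, the cross term satisfies i j < k p q,
-- since (k p q)² = (i² + 1)(j² + 1) > (i j)².
cross-term< : ∀ i j k p q → i * i + 1 ≡ k * (p * p) → j * j + 1 ≡ k * (q * q) →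
              i * j < k * (p * q)
cross-term< i j k p q pell₁ pell₂ = square-cancel-< (begin-strict
  (i * j) * (i * j)                     <⟨ s≤s (m≤m+n _ _) ⟩
  suc ((i * j) * (i * j) + (i * i + j * j)) ≡⟨ expand i j ⟩
  (i * i + 1) * (j * j + 1)             ≡⟨ cong₂ _*_ pell₁ pell₂ ⟩
  (k * (p * p)) * (k * (q * q))         ≡⟨ regroup k p q ⟩
  (k * (p * q)) * (k * (p * q))         ∎)
  where
  open ≤-Reasoning
  expand : ∀ i j → suc ((i * j) * (i * j) + (i * i + j * j)) ≡ (i * i + 1) * (j * j + 1)
  expand = solve-∀
  regroup : ∀ k p q → (k * (p * p)) * (k * (q * q)) ≡ (k * (p * q)) * (k * (p * q))
  regroup = solve-∀

separation : ∀ {i j k p q} → 1 ≤ i → i * i + 1 ≡ k * (p * p) → j * j + 1 ≡ k * (q * q) →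
             i * q ≢ j * p → p < q → suc k * (p * p) ≤ q * q
separation {i} {j} {k} {p} {q} i≥1 pell₁ pell₂ i·q≢j·p p<q
  with <-cmp (i * q) (j * p)
... | tri≈ _ i·q≡j·p _ = contradiction i·q≡j·p i·q≢j·p
... | tri> _ _ j·p<i·q = contradiction p<q (≤⇒≯ q≤p)
  where
  -- roles swapped: p = x q + y j with x ≥ 1
  q≤p : q ≤ p
  q≤p with x , ex ← positive-gap (cross-term< j i k q p pell₂ pell₁)
         | y , ey ← positive-gap j·p<i·q
    = ≤-trans (m≤n*m q (suc x)) (≤-trans (m≤m+n _ _)
        (≤-reflexive (descent j i k q p (suc x) (suc y) pell₂ ex ey)))
... | tri< i·q<j·p _ _ = begin
  suc k * (p * p)        ≡⟨ cong (p * p +_) (sym pell₁) ⟩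
  p * p + (i * i + 1)    ≤⟨ square-of-sum p i p≥1 i≥1 ⟩
  (p + i) * (p + i)      ≤⟨ *-mono-≤ p+i≤q p+i≤q ⟩
  q * q                  ∎
  where
  open ≤-Reasoning
  p≥1 : 1 ≤ p
  p≥1 = proj₂ (pell-positive i k p pell₁)
  -- q = x p + y i with x, y ≥ 1
  p+i≤q : p + i ≤ q
  p+i≤q with x , ex ← positive-gap (cross-term< i j k p q pell₁ pell₂)
           | y , ey ← positive-gap i·q<j·p
    = ≤-trans (+-mono-≤ (m≤n*m p (suc x)) (m≤n*m i (suc y)))
              (≤-reflexive (descent i j k p q (suc x) (suc y) pell₁ ex ey))

prime⇒≢1 : ∀ {p} → Prime p → p ≢ 1
prime⇒≢1 p-prime = nonTrivial⇒≢1 {{prime⇒nonTrivial p-prime}}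

-- For distinct primes p, q with p ∣ i² + 1, the pairs (i, p) and (j, q) are
-- not proportional: i q = j p would force p ∣ i (impossible, as p ∣ i² + 1)
-- or p ∣ q.
not-proportional : ∀ {i j p q} → Prime p → Prime q → p ≢ q → p ∣ i * i + 1 → i * q ≢ j * p
not-proportional {i} {j} {p} {q} p-prime q-prime p≢q p∣i²+1 i·q≡j·p
  with euclidsLemma i q p-prime (divides j i·q≡j·p)
... | inj₁ p∣i = prime⇒≢1 p-prime (∣1⇒≡1 (∣m+n∣m⇒∣n p∣i²+1 (∣m⇒∣m*n i p∣i)))
... | inj₂ p∣q = [ prime⇒≢1 p-prime , p≢q ]′ (prime⇒irreducible q-prime p∣q)

-- Solutions with the same k separated by a factor √2 fall into different
-- blocks of length d ≤ p on the scale 3p: 2p² ≤ q² gives 4p ≤ 3q, so 3p + d ≤ 3q.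
block-separated : ∀ {p q} d .{{_ : NonZero d}} → d ≤ p → 2 * (p * p) ≤ q * q →
                  3 * p / d < 3 * q / d
block-separated {p} {q} d d≤p doubled =
  <-≤-trans (/-step (3 * p) d) (/-monoˡ-≤ d (begin
    3 * p + d ≤⟨ +-monoʳ-≤ (3 * p) d≤p ⟩
    3 * p + p ≡⟨ four p ⟩
    4 * p     ≤⟨ square-cancel-≤ 4p²≤9q² ⟩
    3 * q     ∎))
  where
  open ≤-Reasoning
  four : ∀ p → 3 * p + p ≡ 4 * p
  four = solve-∀
  sixteen : ∀ p → (4 * p) * (4 * p) ≡ 16 * (p * p)
  sixteen = solve-∀
  eighteen : ∀ p → 18 * (p * p) ≡ 9 * (2 * (p * p))
  eighteen = solve-∀
  nine : ∀ q → 9 * (q * q) ≡ (3 * q) * (3 * q)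
  nine = solve-∀
  4p²≤9q² : (4 * p) * (4 * p) ≤ (3 * q) * (3 * q)
  4p²≤9q² = begin
    (4 * p) * (4 * p)   ≡⟨ sixteen p ⟩
    16 * (p * p)        ≤⟨ *-monoˡ-≤ (p * p) (m≤m+n 16 2) ⟩
    18 * (p * p)        ≡⟨ eighteen p ⟩
    9 * (2 * (p * p))   ≤⟨ *-monoʳ-≤ 9 doubled ⟩
    9 * (q * q)         ≡⟨ nine q ⟩
    (3 * q) * (3 * q)   ∎

-- Two solutions with the same large k cannot both lie below a common bound:
-- if k ≥ t, p ≥ b and (k + 1) p² ≤ q², then k q² ≥ t (t + 1) b².
crowded : ∀ {t b k p q} → t ≤ k → b ≤ p → suc k * (p * p) ≤ q * q →
          t * (suc t * (b * b)) ≤ k * (q * q)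
crowded t≤k b≤p separated =
  *-mono-≤ t≤k (≤-trans (*-mono-≤ (s≤s t≤k) (*-mono-≤ b≤p b≤p)) separated)

cube-window : ∀ n → 1 ≤ n → ∃[ b ] (suc b ^ 3 ≤ n × n < 8 * suc b ^ 3)
cube-window (suc zero) _ = 0 , ≤-refl , s≤s (s≤s z≤n)
cube-window (suc (suc m)) _ with cube-window (suc m) (s≤s z≤n)
... | b , lower , upper with suc (suc m) <? 8 * suc b ^ 3
...   | yes upper′ = b , m≤n⇒m≤1+n lower , upper′
...   | no ¬upper =
  pred (2 * suc b) , ≤-reflexive (trans (doubled (suc b)) (sym edge)) , (begin-strict
  suc (suc m)                     ≡⟨ edge ⟩
  8 * suc b ^ 3                   <⟨ m<m+n _ (>-nonZero⁻¹ (56 * suc b ^ 3)) ⟩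
  8 * suc b ^ 3 + 56 * suc b ^ 3  ≡⟨ octupled (suc b) ⟩
  8 * (2 * suc b) ^ 3             ∎)
  where
  open ≤-Reasoning
  -- the window is left exactly at n = 8a³, which starts the window of 2a
  edge : suc (suc m) ≡ 8 * suc b ^ 3
  edge = ≤-antisym upper (≮⇒≥ ¬upper)
  -- (2a)³ = 8a³, written out because the ring solver does not see through _^_
  doubled : ∀ a → (2 * a) * ((2 * a) * ((2 * a) * 1)) ≡ 8 * (a * (a * (a * 1)))
  doubled = solve-∀
  octupled : ∀ a → 8 * (a * (a * (a * 1))) + 56 * (a * (a * (a * 1)))
                   ≡ 8 * ((2 * a) * ((2 * a) * ((2 * a) * 1)))
  octupled = solve-∀

cube-of-bound : ∀ c s n m → s ^ 3 ≤ n ^ 2 → m ≤ c * s → m ^ 3 ≤ c ^ 3 * n ^ 2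
cube-of-bound c s n m s³≤n² m≤c·s = begin
  m ^ 3           ≤⟨ ^-monoˡ-≤ 3 m≤c·s ⟩
  (c * s) ^ 3     ≡⟨ distribute c s ⟩
  c ^ 3 * s ^ 3   ≤⟨ *-monoʳ-≤ (c ^ 3) s³≤n² ⟩
  c ^ 3 * n ^ 2   ∎
  where
  open ≤-Reasoning
  distribute : ∀ c s → (c * s) * ((c * s) * ((c * s) * 1)) ≡ (c * (c * (c * 1))) * (s * (s * (s * 1)))
  distribute = solve-∀

module Window (n b : ℕ) (lower : suc b ^ 3 ≤ n) (upper : n < 8 * suc b ^ 3) where

  a : ℕ
  a = suc b

  -- Every prime of the set is at least A, because p³ ≥ n² ≥ a⁶.
  A : ℕ
  A = a * a

  -- i² + 1 is at most M, because i ≤ n < 8a³.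
  M : ℕ
  M = (8 * a ^ 3) * (8 * a ^ 3)

  -- k < T counts as small; 3p < 48a³ = W · A is covered by W blocks of length A.
  T W : ℕ
  T = 8 * a
  W = 48 * a

  A³≤n² : A ^ 3 ≤ n ^ 2
  A³≤n² = begin
    A ^ 3        ≡⟨ sixth a ⟩
    (a ^ 3) ^ 2  ≤⟨ ^-monoˡ-≤ 2 lower ⟩
    n ^ 2        ∎
    where
    open ≤-Reasoning
    sixth : ∀ a → (a * a) * ((a * a) * ((a * a) * 1)) ≡ (a * (a * (a * 1))) * ((a * (a * (a * 1))) * 1)
    sixth = solve-∀

  record Witness (p : ℕ) : Set where
    field
      k i     : ℕ
      pell    : i * i + 1 ≡ k * (p * p)
      i≥1     : 1 ≤ i
      p-prime : Prime p
      A≤p     : A ≤ p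
      3p<W·A  : 3 * p < W * A
      kp²≤M   : k * (p * p) ≤ M

  -- Every prime of the set comes with a witness: p³ ≥ n² forces p ≥ A,
  -- p ≤ 2n < 16a³ gives 3p < 48a³, and i < 8a³ gives i² + 1 ≤ (8a³)².
  witness : ∀ {p} → InSet n p → Witness p
  witness {p} (p-prime , n²≤p³ , p≤2n , i , i≥1 , i≤n , divides k i²+1≡k·p²) = record
    { k = k ; i = i ; pell = pell ; i≥1 = i≥1 ; p-prime = p-prime
    ; A≤p = A≤p ; 3p<W·A = 3p<W·A ; kp²≤M = kp²≤M }
    where
    open ≤-Reasoning
    square : ∀ m → m ^ 2 ≡ m * m
    square m = cong (m *_) (*-identityʳ m)
    six : ∀ n → 3 * (2 * n) ≡ 6 * n
    six = solve-∀
    forty-eight : ∀ a → 6 * (8 * (a * (a * (a * 1)))) ≡ (48 * a) * (a * a)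
    forty-eight = solve-∀

    pell : i * i + 1 ≡ k * (p * p)
    pell = trans (cong (_+ 1) (sym (square i))) (trans i²+1≡k·p² (cong (k *_) (square p)))

    A≤p : A ≤ p
    A≤p = ≮⇒≥ λ p<A → <⇒≱ (^-monoˡ-< 3 p<A) (≤-trans A³≤n² n²≤p³)

    3p<W·A : 3 * p < W * A
    3p<W·A = begin-strict
      3 * p          ≤⟨ *-monoʳ-≤ 3 p≤2n ⟩
      3 * (2 * n)    ≡⟨ six n ⟩
      6 * n          <⟨ *-monoʳ-< 6 upper ⟩
      6 * (8 * a ^ 3) ≡⟨ forty-eight a ⟩
      W * A          ∎

    kp²≤M : k * (p * p) ≤ M
    kp²≤M = begin
      k * (p * p)    ≡⟨ sym pell ⟩
      i * i + 1      ≡⟨ +-comm (i * i) 1 ⟩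
      suc (i * i)    ≤⟨ *-mono-< (n<1+n i) (n<1+n i) ⟩
      suc i * suc i  ≤⟨ *-mono-≤ i<8a³ i<8a³ ⟩
      M              ∎
      where
      i<8a³ : i < 8 * a ^ 3
      i<8a³ = ≤-<-trans i≤n upper

  open Witness

  k≥1 : ∀ {p} (u : Witness p) → 1 ≤ k u
  k≥1 {p} u = proj₁ (pell-positive (i u) (k u) p (pell u))

  -- Large k are still bounded: k A² ≤ k p² ≤ M = 64 A · A².
  k≤64A : ∀ {p} (u : Witness p) → k u ≤ 64 * A
  k≤64A {p} u = *-cancelʳ-≤ (k u) (64 * A) (A * A) (begin
    k u * (A * A)     ≤⟨ *-monoʳ-≤ (k u) (*-mono-≤ (A≤p u) (A≤p u)) ⟩
    k u * (p * p)     ≤⟨ kp²≤M u ⟩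
    M                 ≡⟨ M≡ a ⟩
    64 * A * (A * A)  ∎)
    where
    open ≤-Reasoning
    M≡ : ∀ a → (8 * (a * (a * (a * 1)))) * (8 * (a * (a * (a * 1)))) ≡ 64 * (a * a) * ((a * a) * (a * a))
    M≡ = solve-∀

  block<W : ∀ {p} → Witness p → 3 * p / A < W
  block<W u = m<n*o⇒m/o<n (3p<W·A u)

  same-k-separated : ∀ {p q} (u : Witness p) (v : Witness q) → k u ≡ k v → p < q →
                     suc (k u) * (p * p) ≤ q * q
  same-k-separated {p} {q} u v same-k p<q =
    separation {i u} {i v} {k u} (i≥1 u) (pell u) pell-v
      (not-proportional {i u} {i v} (p-prime u) (p-prime v) (<⇒≢ p<q) p∣i²+1) p<q
    where
    pell-v : i v * i v + 1 ≡ k u * (q * q)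
    pell-v = trans (pell v) (cong (_* (q * q)) (sym same-k))
    p∣i²+1 : p ∣ i u * i u + 1
    p∣i²+1 = divides (k u * p) (trans (pell u) (sym (*-assoc (k u) p p)))

  -- (8a³)² < 8a (8a + 1) a⁴: two primes sharing a large k would violate the bound M.
  M<crowd : M < T * (suc T * (A * A))
  M<crowd = begin-strict
    M                           <⟨ m<m+n M (>-nonZero⁻¹ (T * (A * A))) ⟩
    M + T * (A * A)             ≡⟨ expand a ⟩
    T * (suc T * (A * A))       ∎
    where
    open ≤-Reasoning
    expand : ∀ a → (8 * (a * (a * (a * 1)))) * (8 * (a * (a * (a * 1)))) + 8 * a * ((a * a) * (a * a))
                   ≡ 8 * a * ((1 + 8 * a) * ((a * a) * (a * a)))
    expand = solve-∀

  classify : ∀ {p} → Witness p → Fin (T * W) ⊎ Fin (suc (64 * A))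
  classify u with k u <? T
  ... | yes k<T = inj₁ (combine (fromℕ< k<T) (fromℕ< (block<W u)))
  ... | no _    = inj₂ (fromℕ< (s≤s (k≤64A u)))

  classes-differ : ∀ {p q} (u : Witness p) (v : Witness q) → p < q → classify u ≢ classify v
  classes-differ {p} {q} u v p<q same with k u <? T | k v <? T
  ... | yes _ | yes _ with same-k , same-block ← combine-injective _ _ _ _ (inj₁-injective same) =
    <⇒≢ (block-separated {p} {q} A (A≤p u) doubled) (fromℕ<-injective _ _ _ _ same-block)
    where
    doubled : 2 * (p * p) ≤ q * q
    doubled = ≤-trans (*-monoˡ-≤ (p * p) (s≤s (k≥1 u)))
                      (same-k-separated u v (fromℕ<-injective _ _ _ _ same-k) p<q)
  ... | no k≮T | no _ = <⇒≱ M<crowd (≤-trans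
    (crowded {q = q} (≮⇒≥ k≮T) (A≤p u) (same-k-separated u v same-k p<q))
    (≤-trans (≤-reflexive (cong (_* (q * q)) same-k)) (kp²≤M v)))
    where
    same-k : k u ≡ k v
    same-k = fromℕ<-injective _ _ _ _ (inj₂-injective same)
  classes-differ u v p<q () | yes _ | no _
  classes-differ u v p<q () | no _ | yes _

  code : ∀ {p} → Witness p → Fin (T * W + suc (64 * A))
  code u = join _ _ (classify u)

  code-injective : ∀ {p q} (u : Witness p) (v : Witness q) → code u ≡ code v → p ≡ q
  code-injective {p} {q} u v same-code with <-cmp p q
  ... | tri< p<q _ _ = contradiction (join-injective _ _ same-code) (classes-differ u v p<q)
  ... | tri≈ _ p≡q _ = p≡q
  ... | tri> _ _ q<p = contradiction (sym (join-injective _ _ same-code)) (classes-differ v u q<p)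

  count : ∀ {ps} → Unique ps → All (InSet n) ps → length ps ≤ 449 * A
  count {ps} uniq inSet = begin
    length ps                 ≤⟨ length-≤-by-code code code-injective uniq (All.map witness inSet) ⟩
    T * W + suc (64 * A)      ≡⟨ collect a ⟩
    1 + 448 * A               ≤⟨ +-monoˡ-≤ (448 * A) (s≤s z≤n) ⟩
    A + 448 * A               ≡⟨ gather A ⟩
    449 * A                   ∎
    where
    open ≤-Reasoning
    collect : ∀ a → 8 * a * (48 * a) + suc (64 * (a * a)) ≡ 1 + 448 * (a * a)
    collect = solve-∀
    gather : ∀ x → x + 448 * x ≡ 449 * x
    gather = solve-∀

  count-cubed : ∀ {ps} → Unique ps → All (InSet n) ps → length ps ^ 3 ≤ 449 ^ 3 * n ^ 2
  count-cubed {ps} uniq inSet = cube-of-bound 449 A n (length ps) A³≤n² (count uniq inSet)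

lemma4p2 : ∃[ C ] ((n : ℕ) → 1 ≤ n → (ps : List ℕ) → Unique ps → All (InSet n) ps →
             length ps ^ 3 ≤ C * n ^ 2)
lemma4p2 = 449 ^ 3 , bound
  where
  bound : (n : ℕ) → 1 ≤ n → (ps : List ℕ) → Unique ps → All (InSet n) ps →
          length ps ^ 3 ≤ 449 ^ 3 * n ^ 2
  bound n n≥1 ps uniq inSet =
    let b , lower , upper = cube-window n n≥1
    in  Window.count-cubed n b lower upper uniq inSet
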